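{- Let $G=(V,E)$ be a connected finite graph, $D$ an effective divisor on $G$, $q\in V$, and $D_q$ the $q$-reduced divisor equivalent to $D$. Let $U$ be the set returned by Dhar's burning algorithm applied to $D$ and $q$ (equivalently, the unique inclusionwise maximal $W\subseteq V\setminus\{q\}$ with $D-Q\mathbf{1}_W\geq 0$), and suppose $U\neq\emptyset$. Let $D'=D-Q\mathbf{1}_U$. Then $\operatorname{dist}(D',D_q)=\operatorname{dist}(D,D_q)-1$.
   Context: Graphs may have parallel edges but no loops. $Q$ is the Laplacian ($Q_{uu}=\deg(u)$, $Q_{uv}=-$number of edges between $u$ and $v$ for $u\ne v$). Divisors are vectors in $\mathbb{Z}^V$, effective if nonnegative; $D\sim D'$ if $D'=D-Qx$ for some $x\in\mathbb{Z}^V$. If $D\sim D'$ there is a unique $x\in\mathbb{Z}^V$ with $x\geq 0$, $\min_v x_v=0$ and $D'=D-Qx$; $\operatorname{dist}(D,D')$ is $\max_v x_v$ for this $x$. An effective divisor $D$ is $q$-reduced if there is no nonempty $U\subseteq V\setminus\{q\}$ with $D-Q\mathbf{1}_U\geq 0$; every effective divisor is equivalent to a unique $q$-reduced divisor. Dhar's burning algorithm: start with $U=V\setminus\{q\}$ and, while some $v\in U$ has more edges to $V\setminus U$ than $D(v)$, remove such $v$ from $U$; return $U$. -}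

module Defs where

open import Data.Nat as ℕ using (ℕ; zero; suc)
open import Data.Integer as ℤ using (ℤ; +_; _-_; _*_; _+_)
open import Data.Fin using (Fin) renaming (zero to fzero; suc to fsuc)
open import Data.Bool using (Bool; true; false)
open import Data.Product using (Σ; ∃; _×_)
open import Relation.Binary.PropositionalEquality using (_≡_)
open import Relation.Nullary using (¬_)

∑ : ∀ {n} → (Fin n → ℤ) → ℤ
∑ {zero}  f = + 0
∑ {suc n} f = f fzero + ∑ {n} (λ i → f (fsuc i))

record Graph : Set where
  field
    n        : ℕ
    mult     : Fin n → Fin n → ℕ
    symmetric : ∀ u v → mult u v ≡ mult v u
    loopless : ∀ v → mult v v ≡ 0
open Graph public

Vertex : Graph → Set
Vertex G = Fin (n G)

data Reachable (G : Graph) : Vertex G → Vertex G → Set where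
  here : ∀ {v} → Reachable G v v
  step : ∀ {u w v} → ℕ._<_ 0 (mult G u w) → Reachable G w v → Reachable G u v

Connected : Graph → Set
Connected G = ∀ u v → Reachable G u v

Divisor : Graph → Set
Divisor G = Vertex G → ℤ

deg : (G : Graph) → Vertex G → ℕ
deg G v = ℤ.∣ ∑ (λ u → + mult G v u) ∣

Lap : (G : Graph) → (Vertex G → ℤ) → Vertex G → ℤ
Lap G x v = (+ deg G v) * x v - ∑ (λ u → (+ mult G v u) * x u)

Effective : (G : Graph) → Divisor G → Set
Effective G D = ∀ v → (+ 0) ℤ.≤ D v

Subset : Graph → Set
Subset G = Vertex G → Bool

𝟙 : (G : Graph) → Subset G → Vertex G → ℤ
𝟙 G U v with U v
... | true  = + 1
... | false = + 0

fire : (G : Graph) → Divisor G → Subset G → Divisor G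
fire G D U v = D v - Lap G (𝟙 G U) v

Equiv : (G : Graph) → Divisor G → Divisor G → Set
Equiv G D D' = Σ (Vertex G → ℤ) λ x → ∀ v → D' v ≡ D v - Lap G x v

Reduced : (G : Graph) → Vertex G → Divisor G → Set
Reduced G q D = Effective G D ×
  (∀ (U : Subset G) → U q ≡ false → (∃ λ v → U v ≡ true) →
     ¬ Effective G (fire G D U))

-- Dist G D D' k : dist(D, D') = k, i.e. for the normalized x (x ≥ 0,
-- min x = 0) with D' = D - Q x we have max x = k.  (x ≥ 0 is encoded by ℕ.)
Dist : (G : Graph) → Divisor G → Divisor G → ℕ → Set
Dist G D D' k = Σ (Vertex G → ℕ) λ x →
  (∃ λ v → x v ≡ 0) ×
  (∀ v → D' v ≡ D v - Lap G (λ u → + x u) v) ×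
  (∀ v → ℕ._≤_ (x v) k) ×
  (∃ λ v → x v ≡ k)

-- Write Dq = D - Q x.  Whenever a q-reduced divisor is obtained from an effective one
-- by a script y, the set where y is minimal can be fired from Dq without losing
-- effectivity, so by reducedness that set contains q: y is minimal at q.  Applied to x
-- this normalises x to a script X ≥ 0 with X q = 0; applied to X - 1_U, the script
-- leading from D - Q 1_U to Dq, it gives X ≥ 1 on U.  Dually the set where X is maximal
-- can be fired from D, so by maximality of U it lies inside U.  Hence X - 1_U is again a
-- normalised script, and its maximum is exactly one less than that of X.
module Submission where

open import Defs
open import Algebra.Properties.CommutativeSemigroup using (interchange)
open import Data.Bool.Base using (Bool; true; false)
open import Data.Fin.Base using (Fin) renaming (zero to fzero; suc to fsuc)
open import Data.Integer.Base as ℤ using (ℤ; +_; _+_; _-_; _*_; -_; ∣_∣; +≤+)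
import Data.Integer.Properties as ℤP
open import Data.Integer.Tactic.RingSolver using (solve-∀)
import Data.List.Extrema as Extrema
open import Data.List.Base using (allFin)
open import Data.List.Membership.Propositional.Properties using (∈-allFin)
import Data.List.Relation.Unary.All as All
open import Data.Nat.Base as ℕ using (ℕ; zero; suc; s≤s; z≤n)
import Data.Nat.Properties as ℕP
open import Data.Product using (∃; _×_; _,_; proj₁)
open import Data.Sum using (_⊎_; inj₁; inj₂)
open import Function using (_∘_)
open import Relation.Binary.Bundles using (TotalOrder)
open import Relation.Binary.PropositionalEquality
open import Relation.Nullary using (does; yes; no; contradiction)
open import Relation.Nullary.Decidable using (dec-true; dec-false)

module _ {b ℓ₁ ℓ₂} (O : TotalOrder b ℓ₁ ℓ₂) where
  open TotalOrder O
  open Extrema O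

  minimiser : ∀ {n} (f : Fin n → Carrier) → Fin n → ∃ λ i → ∀ j → f i ≤ f j
  minimiser f i₀ =
    argmin f i₀ (allFin _) ,
    λ j → All.lookup (f[argmin]≤f[xs] {f = f} i₀ (allFin _)) (∈-allFin j)

  maximiser : ∀ {n} (f : Fin n → Carrier) → Fin n → ∃ λ i → ∀ j → f j ≤ f i
  maximiser f i₀ =
    argmax f i₀ (allFin _) ,
    λ j → All.lookup (f[xs]≤f[argmax] {f = f} i₀ (allFin _)) (∈-allFin j)

+pred : ∀ {n} → 1 ℕ.≤ n → + ℕ.pred n ≡ + n - + 1
+pred (s≤s _) = refl

predWhen : Bool → ℕ → ℕ
predWhen true  n = ℕ.pred n
predWhen false n = n

∑-cong : ∀ {n} {f g : Fin n → ℤ} → (∀ i → f i ≡ g i) → ∑ f ≡ ∑ g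
∑-cong {zero}  f≗g = refl
∑-cong {suc n} f≗g = cong₂ _+_ (f≗g fzero) (∑-cong (f≗g ∘ fsuc))

∑-distrib-+ : ∀ {n} (f g : Fin n → ℤ) → ∑ (λ i → f i + g i) ≡ ∑ f + ∑ g
∑-distrib-+ {zero}  f g = refl
∑-distrib-+ {suc n} f g =
  trans (cong (_+_ (f fzero + g fzero)) (∑-distrib-+ (f ∘ fsuc) (g ∘ fsuc)))
        (interchange ℤP.+-commutativeSemigroup (f fzero) (g fzero) _ _)

∑-neg : ∀ {n} (f : Fin n → ℤ) → ∑ (λ i → - f i) ≡ - ∑ f
∑-neg {zero}  f = refl
∑-neg {suc n} f =
  trans (cong (_+_ (- f fzero)) (∑-neg (f ∘ fsuc))) (sym (ℤP.neg-distrib-+ (f fzero) _))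

∑-*ʳ : ∀ {n} (f : Fin n → ℤ) c → ∑ (λ i → f i * c) ≡ ∑ f * c
∑-*ʳ {zero}  f c = refl
∑-*ʳ {suc n} f c =
  trans (cong (_+_ (f fzero * c)) (∑-*ʳ (f ∘ fsuc) c)) (sym (ℤP.*-distribʳ-+ c (f fzero) _))

∑-nonNeg : ∀ {n} (f : Fin n → ℤ) → (∀ i → + 0 ℤ.≤ f i) → + 0 ℤ.≤ ∑ f
∑-nonNeg {zero}  f f≥0 = ℤP.≤-refl
∑-nonNeg {suc n} f f≥0 = ℤP.+-mono-≤ (f≥0 fzero) (∑-nonNeg (f ∘ fsuc) (f≥0 ∘ fsuc))

∑-nonPos : ∀ {n} (f : Fin n → ℤ) → (∀ i → f i ℤ.≤ + 0) → ∑ f ℤ.≤ + 0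
∑-nonPos {zero}  f f≤0 = ℤP.≤-refl
∑-nonPos {suc n} f f≤0 = ℤP.+-mono-≤ (f≤0 fzero) (∑-nonPos (f ∘ fsuc) (f≤0 ∘ fsuc))

module _ (G : Graph) where

  deg≡∑mult : ∀ v → + deg G v ≡ ∑ (λ u → + mult G v u)
  deg≡∑mult v = ℤP.0≤i⇒+∣i∣≡i (∑-nonNeg {n G} _ (λ _ → +≤+ z≤n))

  Lap-cong : ∀ {x y : Vertex G → ℤ} → (∀ u → x u ≡ y u) → ∀ v → Lap G x v ≡ Lap G y v
  Lap-cong x≗y v =
    cong₂ _-_ (cong (+ deg G v *_) (x≗y v)) (∑-cong (λ u → cong (+ mult G v u *_) (x≗y u)))

  Lap-local : ∀ x v → Lap G x v ≡ ∑ (λ u → + mult G v u * (x v - x u))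
  Lap-local x v = begin
    + deg G v * x v - ∑ (λ u → + mult G v u * x u)
      ≡⟨ cong (λ d → d * x v - ∑ (λ u → + mult G v u * x u)) (deg≡∑mult v) ⟩
    ∑ (λ u → + mult G v u) * x v - ∑ (λ u → + mult G v u * x u)
      ≡⟨ cong₂ _+_ (sym (∑-*ʳ {n G} _ (x v))) (sym (∑-neg {n G} _)) ⟩
    ∑ (λ u → + mult G v u * x v) + ∑ (λ u → - (+ mult G v u * x u))
      ≡⟨ sym (∑-distrib-+ {n G} _ _) ⟩
    ∑ (λ u → + mult G v u * x v - + mult G v u * x u)
      ≡⟨ ∑-cong (λ u → factor (+ mult G v u) (x v) (x u)) ⟩
    ∑ (λ u → + mult G v u * (x v - x u)) ∎
    where
    open ≡-Reasoning
    factor : ∀ a p r → a * p - a * r ≡ a * (p - r)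
    factor = solve-∀

  Lap-+ : ∀ x y v → Lap G (λ u → x u + y u) v ≡ Lap G x v + Lap G y v
  Lap-+ x y v = begin
    Lap G (λ u → x u + y u) v
      ≡⟨ Lap-local _ v ⟩
    ∑ (λ u → + mult G v u * ((x v + y v) - (x u + y u)))
      ≡⟨ ∑-cong (λ u → distrib (+ mult G v u) (x v) (y v) (x u) (y u)) ⟩
    ∑ (λ u → + mult G v u * (x v - x u) + + mult G v u * (y v - y u))
      ≡⟨ ∑-distrib-+ {n G} _ _ ⟩
    ∑ (λ u → + mult G v u * (x v - x u)) + ∑ (λ u → + mult G v u * (y v - y u))
      ≡⟨ sym (cong₂ _+_ (Lap-local x v) (Lap-local y v)) ⟩
    Lap G x v + Lap G y v ∎
    where
    open ≡-Reasoning
    distrib : ∀ a p q r s → a * ((p + q) - (r + s)) ≡ a * (p - r) + a * (q - s)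
    distrib = solve-∀

  Lap-neg : ∀ x v → Lap G (λ u → - x u) v ≡ - Lap G x v
  Lap-neg x v = begin
    Lap G (λ u → - x u) v
      ≡⟨ Lap-local _ v ⟩
    ∑ (λ u → + mult G v u * (- x v - - x u))
      ≡⟨ ∑-cong (λ u → distrib (+ mult G v u) (x v) (x u)) ⟩
    ∑ (λ u → - (+ mult G v u * (x v - x u)))
      ≡⟨ ∑-neg {n G} _ ⟩
    - ∑ (λ u → + mult G v u * (x v - x u))
      ≡⟨ cong -_ (sym (Lap-local x v)) ⟩
    - Lap G x v ∎
    where
    open ≡-Reasoning
    distrib : ∀ a p r → a * (- p - - r) ≡ - (a * (p - r))
    distrib = solve-∀

  Lap-shift : ∀ x c v → Lap G (λ u → x u + c) v ≡ Lap G x v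
  Lap-shift x c v =
    trans (Lap-local _ v)
          (trans (∑-cong (λ u → cong (+ mult G v u *_) (cancel (x v) (x u) c)))
                 (sym (Lap-local x v)))
    where
    cancel : ∀ p r c → (p + c) - (r + c) ≡ p - r
    cancel = solve-∀

  Lap-nonPos-at-minimum : ∀ x v → (∀ u → x v ℤ.≤ x u) → Lap G x v ℤ.≤ + 0
  Lap-nonPos-at-minimum x v x≥xv =
    subst (ℤ._≤ + 0) (sym (Lap-local x v)) (∑-nonPos {n G} _ term≤0)
    where
    term≤0 : ∀ u → + mult G v u * (x v - x u) ℤ.≤ + 0
    term≤0 u = ℤP.≤-trans (ℤP.*-monoˡ-≤-nonNeg (+ mult G v u) (ℤP.i≤j⇒i-j≤0 (x≥xv u)))
                          (ℤP.≤-reflexive (ℤP.*-zeroʳ (+ mult G v u)))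

  script-reverse : ∀ {E F : Divisor G} x → (∀ v → F v ≡ E v - Lap G x v) →
                   ∀ v → E v ≡ F v - Lap G (λ u → - x u) v
  script-reverse {E} x F≡ v =
    sym (trans (cong₂ _-_ (F≡ v) (Lap-neg x v)) (cancel (E v) (Lap G x v)))
    where
    cancel : ∀ e l → (e - l) - - l ≡ e
    cancel = solve-∀

  𝟙-true : ∀ {U : Subset G} {u} → U u ≡ true → 𝟙 G U u ≡ + 1
  𝟙-true {U} {u} u∈U rewrite u∈U = refl

  𝟙-false : ∀ {U : Subset G} {u} → U u ≡ false → 𝟙 G U u ≡ + 0
  𝟙-false {U} {u} u∉U rewrite u∉U = refl

  script-after-firing : ∀ {E F : Divisor G} (U : Subset G) x → (∀ v → F v ≡ E v - Lap G x v) →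
                        ∀ v → F v ≡ fire G E U v - Lap G (λ u → x u - 𝟙 G U u) v
  script-after-firing {E} {F} U x F≡ v = begin
    F v
      ≡⟨ F≡ v ⟩
    E v - Lap G x v
      ≡⟨ cong (_-_ (E v)) (Lap-cong (λ u → split (x u) (𝟙 G U u)) v) ⟩
    E v - Lap G (λ u → (x u - 𝟙 G U u) + 𝟙 G U u) v
      ≡⟨ cong (_-_ (E v)) (Lap-+ _ _ v) ⟩
    E v - (Lap G (λ u → x u - 𝟙 G U u) v + Lap G (𝟙 G U) v)
      ≡⟨ swap (E v) _ _ ⟩
    fire G E U v - Lap G (λ u → x u - 𝟙 G U u) v ∎
    where
    open ≡-Reasoning
    split : ∀ p i → p ≡ (p - i) + i
    split = solve-∀
    swap : ∀ e a b → e - (a + b) ≡ (e - b) - a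
    swap = solve-∀

  levelSet : (Vertex G → ℤ) → ℤ → Subset G
  levelSet y m u = does (y u ℤP.≟ m)

  levelSet-cases : ∀ y m → (∀ u → m ℤ.≤ y u) →
                   ∀ u → (levelSet y m u ≡ true × y u ≡ m) ⊎ (levelSet y m u ≡ false × m ℤ.< y u)
  levelSet-cases y m m≤y u with y u ℤP.≟ m
  ... | yes yu≡m = inj₁ (refl , yu≡m)
  ... | no  yu≢m = inj₂ (refl , ℤP.≤∧≢⇒< (m≤y u) (yu≢m ∘ sym))

  -- On T the script y + 1_T is minimal, so there fire F T = E - Q (y + 1_T) ≥ E;
  -- off T, firing T only adds chips.
  fire-levelSet-effective : ∀ {E F : Divisor G} y m →
    Effective G E → Effective G F → (∀ v → F v ≡ E v - Lap G y v) → (∀ u → m ℤ.≤ y u) →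
    Effective G (fire G F (levelSet y m))
  fire-levelSet-effective {E} {F} y m E≥0 F≥0 F≡ m≤y v with levelSet-cases y m m≤y v
  ... | inj₂ (v∉T , _) =
    ℤP.i≤j⇒0≤j-i (ℤP.≤-trans (Lap-nonPos-at-minimum (𝟙 G T) v 𝟙-min) (F≥0 v))
    where
    T = levelSet y m
    𝟙-min : ∀ u → 𝟙 G T v ℤ.≤ 𝟙 G T u
    𝟙-min u rewrite 𝟙-false {T} {v} v∉T with T u
    ... | true  = +≤+ z≤n
    ... | false = +≤+ z≤n
  ... | inj₁ (v∈T , yv≡m) =
    subst (+ 0 ℤ.≤_) (sym fire≡)
      (ℤP.i≤j⇒0≤j-i (ℤP.≤-trans (Lap-nonPos-at-minimum z v z-min) (E≥0 v)))
    where
    T = levelSet y m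
    z : Vertex G → ℤ
    z u = y u + 𝟙 G T u
    fire≡ : fire G F T v ≡ E v - Lap G z v
    fire≡ = begin
      F v - Lap G (𝟙 G T) v               ≡⟨ cong (_- Lap G (𝟙 G T) v) (F≡ v) ⟩
      E v - Lap G y v - Lap G (𝟙 G T) v   ≡⟨ regroup (E v) _ _ ⟩
      E v - (Lap G y v + Lap G (𝟙 G T) v) ≡⟨ cong (_-_ (E v)) (sym (Lap-+ y (𝟙 G T) v)) ⟩
      E v - Lap G z v                     ∎
      where
      open ≡-Reasoning
      regroup : ∀ e a b → e - a - b ≡ e - (a + b)
      regroup = solve-∀
    z-min : ∀ u → z v ℤ.≤ z u
    z-min u rewrite 𝟙-true {T} {v} v∈T | yv≡m with levelSet-cases y m m≤y u
    ... | inj₁ (u∈T , yu≡m) rewrite u∈T | yu≡m = ℤP.≤-refl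
    ... | inj₂ (u∉T , m<yu) rewrite u∉T = begin
      m + + 1   ≡⟨ ℤP.+-comm m (+ 1) ⟩
      ℤ.suc m   ≤⟨ ℤP.i<j⇒suc[i]≤j m<yu ⟩
      y u       ≡⟨ ℤP.+-identityʳ (y u) ⟨
      y u + + 0 ∎
      where open ℤP.≤-Reasoning

  reduced-script-minimal-at : ∀ {q Dq E} → Reduced G q Dq → Effective G E → ∀ y →
    (∀ v → Dq v ≡ E v - Lap G y v) → ∀ u → y q ℤ.≤ y u
  reduced-script-minimal-at {q} (Dq≥0 , no-firing) E≥0 y Dq≡ u
    with minimiser ℤP.≤-totalOrder y q
  ... | i , yi≤y with y q ℤP.≟ y i
  ...   | yes yq≡yi = ℤP.≤-trans (ℤP.≤-reflexive yq≡yi) (yi≤y u)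
  ...   | no  yq≢yi = contradiction (fire-levelSet-effective y (y i) E≥0 Dq≥0 Dq≡ yi≤y)
                        (no-firing (levelSet y (y i)) (dec-false (y q ℤP.≟ y i) yq≢yi)
                          (i , dec-true (y i ℤP.≟ y i) refl))

  normalised-script : ∀ {q D Dq} → Reduced G q Dq → Effective G D → Equiv G D Dq →
    ∃ λ (X : Vertex G → ℕ) → X q ≡ 0 × (∀ v → Dq v ≡ D v - Lap G (λ u → + X u) v)
  normalised-script {q} {D} Dq-reduced D≥0 (x , Dq≡) =
    X , cong ∣_∣ (ℤP.+-inverseʳ (x q)) ,
    λ v → trans (Dq≡ v) (cong (_-_ (D v)) (sym (LapX≡Lapx v)))
    where
    X : Vertex G → ℕ
    X u = ∣ x u - x q ∣
    +X≡ : ∀ u → + X u ≡ x u - x q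
    +X≡ u = ℤP.0≤i⇒+∣i∣≡i (ℤP.i≤j⇒0≤j-i (reduced-script-minimal-at Dq-reduced D≥0 x Dq≡ u))
    LapX≡Lapx : ∀ v → Lap G (λ u → + X u) v ≡ Lap G x v
    LapX≡Lapx v = trans (Lap-cong +X≡ v) (Lap-shift x (- x q) v)

  reduced-script-positive-on-fired : ∀ {q D Dq} {U : Subset G} →
    Reduced G q Dq → Effective G (fire G D U) → U q ≡ false →
    (X : Vertex G → ℕ) → X q ≡ 0 → (∀ v → Dq v ≡ D v - Lap G (λ u → + X u) v) →
    ∀ u → U u ≡ true → 1 ℕ.≤ X u
  reduced-script-positive-on-fired {q} {D} {U = U} Dq-reduced DU≥0 q∉U X Xq≡0 Dq≡ u u∈U =
    ℤP.drop‿+≤+ (ℤP.0≤i-j⇒j≤i (subst₂ ℤ._≤_ at-q at-u minimal))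
    where
    minimal : + X q - 𝟙 G U q ℤ.≤ + X u - 𝟙 G U u
    minimal = reduced-script-minimal-at Dq-reduced DU≥0 (λ u → + X u - 𝟙 G U u)
                (script-after-firing {E = D} U _ Dq≡) u
    at-q : + X q - 𝟙 G U q ≡ + 0
    at-q = cong₂ _-_ (cong +_ Xq≡0) (𝟙-false {U} {q} q∉U)
    at-u : + X u - 𝟙 G U u ≡ + X u - + 1
    at-u = cong (_-_ (+ X u)) (𝟙-true {U} {u} u∈U)

  maximisers-⊆-maximal-firable : ∀ {q D Dq} {U : Subset G} → Effective G D → Effective G Dq →
    (∀ (W : Subset G) → W q ≡ false → Effective G (fire G D W) → ∀ v → W v ≡ true → U v ≡ true) →
    (X : Vertex G → ℕ) (K : ℕ) → (∀ v → Dq v ≡ D v - Lap G (λ u → + X u) v) →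
    (∀ u → X u ℕ.≤ K) → X q ≢ K → ∀ u → X u ≡ K → U u ≡ true
  maximisers-⊆-maximal-firable {q} D≥0 Dq≥0 U-maximal X K Dq≡ X≤K Xq≢K u Xu≡K =
    U-maximal (levelSet (λ u → - + X u) (- + K)) q∉maxSet
      (fire-levelSet-effective _ _ Dq≥0 D≥0 (script-reverse _ Dq≡)
        (λ u → ℤP.neg-mono-≤ (+≤+ (X≤K u))))
      u (dec-true (- + X u ℤP.≟ - + K) (cong (-_ ∘ +_) Xu≡K))
    where
    q∉maxSet : levelSet (λ u → - + X u) (- + K) q ≡ false
    q∉maxSet = dec-false (- + X q ℤP.≟ - + K) (Xq≢K ∘ ℤP.+-injective ∘ ℤP.neg-injective)

  +predWhen : ∀ (U : Subset G) (X : Vertex G → ℕ) u → (U u ≡ true → 1 ℕ.≤ X u) →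
              + predWhen (U u) (X u) ≡ + X u - 𝟙 G U u
  +predWhen U X u U⇒pos with U u
  ... | true  = +pred (U⇒pos refl)
  ... | false = sym (ℤP.+-identityʳ (+ X u))

  dist-after-firing : ∀ {q D Dq} {U : Subset G} (X : Vertex G → ℕ) K w →
    X q ≡ 0 → (∀ v → Dq v ≡ D v - Lap G (λ u → + X u) v) → U q ≡ false →
    (∀ u → U u ≡ true → 1 ℕ.≤ X u) → (∀ u → X u ℕ.≤ K) → (∀ u → X u ≡ K → U u ≡ true) →
    X w ≡ K → Dist G (fire G D U) Dq (ℕ.pred K)
  dist-after-firing {q} {D} {Dq} {U} X K w Xq≡0 Dq≡ q∉U U⇒pos X≤K max⊆U Xw≡K =
    Y , (q , cong₂ predWhen q∉U Xq≡0) , Dq≡DU-QY , Y≤predK ,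
    (w , cong₂ predWhen (max⊆U w Xw≡K) Xw≡K)
    where
    Y : Vertex G → ℕ
    Y u = predWhen (U u) (X u)
    Dq≡DU-QY : ∀ v → Dq v ≡ fire G D U v - Lap G (λ u → + Y u) v
    Dq≡DU-QY v = trans (script-after-firing {E = D} U _ Dq≡ v)
      (cong (_-_ (fire G D U v)) (Lap-cong (λ u → sym (+predWhen U X u (U⇒pos u))) v))
    Y≤predK : ∀ u → predWhen (U u) (X u) ℕ.≤ ℕ.pred K
    Y≤predK u with U u | max⊆U u
    ... | true  | _        = ℕP.pred-mono-≤ (X≤K u)
    ... | false | max⇒true =
      ℕP.<⇒≤pred (ℕP.≤∧≢⇒< (X≤K u) (λ Xu≡K → contradiction (max⇒true Xu≡K) λ ()))

lemma4 : (G : Graph) → Connected G →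
         (D : Divisor G) → Effective G D →
         (q : Vertex G) →
         (Dq : Divisor G) → Equiv G D Dq → Reduced G q Dq →
         (U : Subset G) → U q ≡ false → Effective G (fire G D U) →
         (∀ (W : Subset G) → W q ≡ false → Effective G (fire G D W) →
            ∀ v → W v ≡ true → U v ≡ true) →
         (∃ λ v → U v ≡ true) →
         ∃ λ k → Dist G D Dq (suc k) × Dist G (fire G D U) Dq k
lemma4 G _ D D≥0 q Dq D~Dq Dq-reduced U q∉U DU≥0 U-maximal (u₀ , u₀∈U)
  with normalised-script G Dq-reduced D≥0 D~Dq
... | X , Xq≡0 , Dq≡D-QX with maximiser ℕP.≤-totalOrder X q
... | w , X≤K =
  ℕ.pred K ,
  subst (Dist G D Dq) (sym (ℕP.suc-pred K)) (X , (q , Xq≡0) , Dq≡D-QX , X≤K , (w , refl)) ,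
  dist-after-firing G {D = D} X K w Xq≡0 Dq≡D-QX q∉U fired-positive X≤K max⊆U refl
  where
  K = X w
  fired-positive : ∀ u → U u ≡ true → 1 ℕ.≤ X u
  fired-positive = reduced-script-positive-on-fired G {D = D} Dq-reduced DU≥0 q∉U X Xq≡0 Dq≡D-QX
  instance
    K-nonZero : ℕ.NonZero K
    K-nonZero = ℕ.>-nonZero (ℕP.≤-trans (fired-positive u₀ u₀∈U) (X≤K u₀))
  max⊆U : ∀ u → X u ≡ K → U u ≡ true
  max⊆U = maximisers-⊆-maximal-firable G D≥0 (proj₁ Dq-reduced) U-maximal X K Dq≡D-QX X≤K
            (λ Xq≡K → ℕ.≢-nonZero⁻¹ K (trans (sym Xq≡K) Xq≡0))
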